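{- Let $n$ be a positive integer. If there exists a Kirkman frame of type $6^n$ which contains as a subdesign a $3$-GDD of type $3^n$, then there exists a Kirkman triple system of order $6n+3$ which contains as a subdesign a Steiner triple system of order $3n$.
   Context: An STS$(v)$ is a set of $v$ points with a set of 3-subsets (blocks) such that each pair of distinct points lies in exactly one block; a KTS$(v)$ is an STS$(v)$ whose blocks partition into parallel classes (partitions of the point set); a subdesign is a subset of points with a subset of blocks forming an STS on that subset. A 3-GDD of type $g^u$ on a point set $V$ is a partition of $V$ into $u$ groups of size $g$ with a set of 3-subset blocks, each meeting every group in at most one point, such that any two points in different groups lie in exactly one block. A Kirkman frame is a 3-GDD whose blocks can be partitioned into partial parallel classes, each a partition of $V\setminus V_i$ for some group $V_i$. A Kirkman frame of type $h^u$ (groups $V_i$, blocks $\mathcal{B}$) contains a 3-GDD of type $g^u$ (groups $W_i$, blocks $\mathcal{A}$) as a subdesign if $W_i\subseteq V_i$ for all $i$ and $\mathcal{A}\subseteq\mathcal{B}$. -}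

module Defs where

open import Data.Nat using (ℕ; _*_)
open import Data.Fin using (Fin; _≟_)
open import Data.Fin.Subset using (Subset; _∈_; _∉_; _∩_; ∣_∣; ⊤)
open import Data.Vec using (tabulate)
open import Data.Product using (Σ; _×_; ∃)
open import Data.Empty using (⊥)
open import Relation.Nullary using (¬_; does)
open import Relation.Binary.PropositionalEquality using (_≡_; _≢_)

BlockSet : ℕ → Set₁
BlockSet v = Subset v → Set

ExactlyOne : ∀ {v} → (Subset v → Set) → Set
ExactlyOne {v} P = Σ (Subset v) λ b → P b × (∀ b' → P b' → b' ≡ b)

NoneSat : ∀ {v} → (Subset v → Set) → Set
NoneSat {v} P = ∀ b → P b → ⊥

_⊆ᴮ_ : ∀ {v} → BlockSet v → BlockSet v → Set
_⊆ᴮ_ {v} A B = ∀ (b : Subset v) → A b → B b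

TriplesIn : ∀ {v} → Subset v → BlockSet v → Set
TriplesIn {v} W B = ∀ (b : Subset v) → B b → (∣ b ∣ ≡ 3) × (∀ x → x ∈ b → x ∈ W)

STSOn : ∀ {v} → Subset v → BlockSet v → Set
STSOn {v} W B = TriplesIn W B ×
  (∀ (x y : Fin v) → x ∈ W → y ∈ W → x ≢ y →
     ExactlyOne (λ b → B b × x ∈ b × y ∈ b))

STS : (v : ℕ) → BlockSet v → Set
STS v B = STSOn ⊤ B

Resolution : (v : ℕ) → BlockSet v → Set
Resolution v B = Σ ℕ λ r → Σ (Subset v → Fin r) λ cls →
  ∀ (j : Fin r) (x : Fin v) → ExactlyOne (λ b → B b × cls b ≡ j × x ∈ b)

KTS : (v : ℕ) → BlockSet v → Set
KTS v B = STS v B × Resolution v B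

group : ∀ {v u} → (Fin v → Fin u) → Fin u → Subset v
group grp i = tabulate λ x → does (grp x ≟ i)

GDDOn : ∀ {v u} → Subset v → (Fin v → Fin u) → ℕ → BlockSet v → Set
GDDOn {v} {u} W grp g B =
  (∀ (i : Fin u) → ∣ W ∩ group grp i ∣ ≡ g) ×
  TriplesIn W B ×
  (∀ (b : Subset v) → B b → ∀ x y → x ∈ b → y ∈ b → grp x ≡ grp y → x ≡ y) ×
  (∀ (x y : Fin v) → x ∈ W → y ∈ W → grp x ≢ grp y →
     ExactlyOne (λ b → B b × x ∈ b × y ∈ b))

-- Kirkman frame of type g^u on Fin v (groups given by grp): a 3-GDD whose
-- blocks are partitioned into partial parallel classes, class j being a
-- partition of Fin v ∖ V_(hole j).
KirkmanFrame : ∀ {v u} → (Fin v → Fin u) → ℕ → BlockSet v → Set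
KirkmanFrame {v} {u} grp g B = GDDOn ⊤ grp g B ×
  (Σ ℕ λ r → Σ (Subset v → Fin r) λ cls → Σ (Fin r → Fin u) λ hole →
    ∀ (j : Fin r) (x : Fin v) →
      (grp x ≡ hole j → NoneSat (λ b → B b × cls b ≡ j × x ∈ b)) ×
      (grp x ≢ hole j → ExactlyOne (λ b → B b × cls b ≡ j × x ∈ b)))

{-# OPTIONS --safe #-}
module Submission where

-- Adjoin three points ∞₀, ∞₁, ∞₂. For every group V_i the nine points V_i ∪ {∞₀, ∞₁, ∞₂} are
-- identified with the affine plane AG(2,3) so that {∞₀, ∞₁, ∞₂}, W ∩ V_i and V_i ∖ W are the
-- three lines of one parallel class; the new blocks are the frame blocks and the lines of all
-- these planes (the line at infinity being common to all of them). The rows of all the planes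
-- form one parallel class. Counting the blocks through a point of V_h shows that every group
-- V_h is the hole of exactly three partial parallel classes of the frame, and these are
-- completed by the three remaining parallel classes of the plane on V_h ∪ {∞₀, ∞₁, ∞₂}. The
-- blocks of the 3-GDD on W together with the lines W ∩ V_i form the STS(3n) on W.

open import Defs
open import Data.Nat using (ℕ; zero; suc; _*_; _+_; _≤_; NonZero; ≢-nonZero⁻¹)
open import Data.Nat.Properties
  using (+-*-semiring; +-comm; +-identityʳ; +-cancelˡ-≡; +-cancelʳ-≡;
         *-comm; *-suc; *-zeroʳ; *-identityʳ; *-cancelˡ-≡; m*n≢0)
open import Data.Nat.DivMod using (_mod_)
open import Data.Nat.Tactic.RingSolver using (solve-∀)
open import Data.Bool using (Bool; true; false; _∧_; _∨_; not)
open import Data.Bool.Properties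
  using (∧-conicalˡ; ∧-conicalʳ; ∧-zeroʳ; ∧-identityʳ; ∨-zeroʳ; ¬-not; not-¬)
import Data.Bool.Properties as Bool
open import Data.Fin using (Fin; zero; suc; _≟_; toℕ; _↑ˡ_; _↑ʳ_; splitAt; join)
open import Data.Fin.Patterns using (0F; 1F; 2F)
open import Data.Fin.Properties using (all?; any?)
import Data.Fin.Properties as Finₚ
open import Data.Fin.Subset using (Subset; _∈_; ∣_∣; ⊤; _∩_) renaming (⊥ to ∅)
open import Data.Fin.Subset.Properties using (∣⊥∣≡0)
open import Data.Vec using ([]; _∷_; _++_; lookup; tabulate)
open import Data.Vec.Properties
  using ([]=⇒lookup; lookup⇒[]=; lookup∘tabulate; lookup-zipWith; lookup-replicate;
         lookup-++ˡ; lookup-++ʳ; tabulate-cong; tabulate∘lookup)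
import Data.Vec.Properties as Vec
open import Data.Product using (Σ; _×_; _,_; proj₁; proj₂)
open import Data.Product.Properties using (≡-dec)
open import Data.Sum using (_⊎_; inj₁; inj₂; [_,_]′)
open import Data.Empty using (⊥-elim)
open import Function using (_∘_)
open import Relation.Nullary using (¬_; Dec; does; yes; no)
open import Relation.Nullary.Decidable
  using (dec-true; dec-false; toWitness; map′; ¬?; _→-dec_; _×-dec_; _⊎-dec_)
open import Relation.Binary using (DecidableEquality)
open import Relation.Binary.PropositionalEquality
open import Algebra.Properties.Semiring.Sum +-*-semiring
  using (sum-syntax; sum-cong-≗; ∑-comm; ∑-distrib-+; *-distribˡ-sum)

infix 4 _==_

_==_ : ∀ {n} → Fin n → Fin n → Bool
x == y = does (x ≟ y)

module _ {n : ℕ} where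

  ≡⇒== : {x y : Fin n} → x ≡ y → (x == y) ≡ true
  ≡⇒== {x} {y} = dec-true (x ≟ y)

  ==-refl : (x : Fin n) → (x == x) ≡ true
  ==-refl x = ≡⇒== {x} refl

  ==⇒≡ : {x y : Fin n} → (x == y) ≡ true → x ≡ y
  ==⇒≡ {x} {y} e with x ≟ y
  ==⇒≡ _ | yes x≡y = x≡y
  ==⇒≡ () | no _

  ≢⇒==false : {x y : Fin n} → ¬ x ≡ y → (x == y) ≡ false
  ≢⇒==false {x} {y} = dec-false (x ≟ y)

∨-true : ∀ a {b} → (a ∨ b) ≡ true → a ≡ true ⊎ b ≡ true
∨-true true _ = inj₁ refl
∨-true false e = inj₂ e

not-true : ∀ {a} → not a ≡ true → a ≡ false
not-true {false} _ = refl

≡true-ext : ∀ {a b : Bool} → (a ≡ true → b ≡ true) → (b ≡ true → a ≡ true) → a ≡ b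
≡true-ext {true} f _ = sym (f refl)
≡true-ext {false} {true} _ g = g refl
≡true-ext {false} {false} _ _ = refl

iverson : Bool → ℕ
iverson true = 1
iverson false = 0

count : ∀ {v} → (Fin v → Bool) → ℕ
count {v} f = ∑[ x < v ] iverson (f x)

∑-const : ∀ n c → ∑[ i < n ] c ≡ n * c
∑-const zero c = refl
∑-const (suc n) c = cong (c +_) (∑-const n c)

∣p∣≡count : ∀ {v} (p : Subset v) → ∣ p ∣ ≡ count (lookup p)
∣p∣≡count [] = refl
∣p∣≡count (true ∷ p) = cong suc (∣p∣≡count p)
∣p∣≡count (false ∷ p) = ∣p∣≡count p

module _ {v : ℕ} where

  count-cong : {f g : Fin v → Bool} → (∀ x → f x ≡ g x) → count f ≡ count g
  count-cong e = sum-cong-≗ (cong iverson ∘ e)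

  count-false : (f : Fin v → Bool) → (∀ x → f x ≡ false) → count f ≡ 0
  count-false f e = trans (count-cong e) (trans (∑-const v 0) (*-zeroʳ v))

  count-true : count {v} (λ _ → true) ≡ v
  count-true = trans (∑-const v 1) (*-identityʳ v)

  ∣tabulate∣≡count : (f : Fin v → Bool) → ∣ tabulate f ∣ ≡ count f
  ∣tabulate∣≡count f = trans (∣p∣≡count (tabulate f)) (count-cong (lookup∘tabulate f))

  count-partition : (f g : Fin v → Bool) →
    count (λ x → f x ∧ g x) + count (λ x → not (f x) ∧ g x) ≡ count g
  count-partition f g =
    trans (sym (∑-distrib-+ (λ x → iverson (f x ∧ g x)) (λ x → iverson (not (f x) ∧ g x))))
          (sum-cong-≗ (λ x → split (f x) (g x)))
    where
    split : ∀ a b → iverson (a ∧ b) + iverson (not a ∧ b) ≡ iverson b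
    split true b = +-identityʳ (iverson b)
    split false b = refl

  count-∨ : (f g : Fin v → Bool) → (∀ x → (f x ∧ g x) ≡ false) →
    count (λ x → f x ∨ g x) ≡ count f + count g
  count-∨ f g disjoint =
    trans (sum-cong-≗ (λ x → split (f x) (g x) (disjoint x))) (∑-distrib-+ (iverson ∘ f) (iverson ∘ g))
    where
    split : ∀ a b → (a ∧ b) ≡ false → iverson (a ∨ b) ≡ iverson a + iverson b
    split true false _ = refl
    split false b _ = refl

count-== : ∀ {v} (x : Fin v) → count (_== x) ≡ 1
count-== {suc v} zero = cong suc (count-false {v} (λ y → suc y == zero) (λ _ → refl))
count-== {suc v} (suc x) = count-== x

count-three : ∀ {v} {a b c : Fin v} → ¬ a ≡ b → ¬ a ≡ c → ¬ b ≡ c →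
  count (λ y → (y == a) ∨ ((y == b) ∨ (y == c))) ≡ 3
count-three {a = a} {b} {c} a≢b a≢c b≢c = begin
  count (λ y → (y == a) ∨ ((y == b) ∨ (y == c)))
    ≡⟨ count-∨ (_== a) _ (λ y → apart y a≢b a≢c) ⟩
  count (_== a) + count (λ y → (y == b) ∨ (y == c))
    ≡⟨ cong (count (_== a) +_) (count-∨ (_== b) (_== c) (λ y → apart₁ y b≢c)) ⟩
  count (_== a) + (count (_== b) + count (_== c))
    ≡⟨ cong₂ _+_ (count-== a) (cong₂ _+_ (count-== b) (count-== c)) ⟩
  3 ∎
  where
  open ≡-Reasoning
  apart₁ : ∀ {x y} z → ¬ x ≡ y → ((z == x) ∧ (z == y)) ≡ false
  apart₁ {x} {y} z x≢y with z ≟ x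
  ... | yes refl = ≢⇒==false x≢y
  ... | no _ = refl
  apart : ∀ z → ¬ a ≡ b → ¬ a ≡ c → ((z == a) ∧ ((z == b) ∨ (z == c))) ≡ false
  apart z a≢b a≢c with z ≟ a
  ... | yes refl = cong₂ _∨_ (≢⇒==false a≢b) (≢⇒==false a≢c)
  ... | no _ = refl

count≢0⇒witness : ∀ {v} (f : Fin v → Bool) → ¬ count f ≡ 0 → Σ (Fin v) λ x → f x ≡ true
count≢0⇒witness {zero} f count≢0 = ⊥-elim (count≢0 refl)
count≢0⇒witness {suc v} f count≢0 with f zero in f0
... | true = zero , f0
... | false = let x , fx = count≢0⇒witness (f ∘ suc) count≢0 in suc x , fx

count-remove : ∀ {v} (f : Fin v → Bool) (x : Fin v) → f x ≡ true →
  count (λ y → not (y == x) ∧ f y) + 1 ≡ count f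
count-remove f x fx = begin
  count (λ y → not (y == x) ∧ f y) + 1 ≡⟨ +-comm _ 1 ⟩
  1 + count (λ y → not (y == x) ∧ f y) ≡⟨ cong (_+ count (λ y → not (y == x) ∧ f y)) (sym singleton) ⟩
  count (λ y → (y == x) ∧ f y) + count (λ y → not (y == x) ∧ f y) ≡⟨ count-partition (_== x) f ⟩
  count f ∎
  where
  open ≡-Reasoning
  singleton : count (λ y → (y == x) ∧ f y) ≡ 1
  singleton = trans (count-cong only-x) (count-== x)
    where
    only-x : ∀ y → ((y == x) ∧ f y) ≡ (y == x)
    only-x y with y ≟ x
    ... | yes refl = fx
    ... | no _ = refl

count-fibres : ∀ {a b} (Q : Fin a → Bool) (g : Fin a → Fin b) →
  count Q ≡ ∑[ j < b ] count (λ x → Q x ∧ (g x == j))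
count-fibres {a} {b} Q g = trans (sum-cong-≗ (λ x → sym (∑-iverson (Q x) (g x))))
  (∑-comm (λ x j → iverson (Q x ∧ (g x == j))))
  where
  ∑-iverson : ∀ {b} q (k : Fin b) → ∑[ j < b ] iverson (q ∧ (k == j)) ≡ iverson q
  ∑-iverson {suc b} q zero =
    trans (cong₂ _+_ (cong iverson (∧-identityʳ q)) (count-false {b} _ (λ _ → ∧-zeroʳ q))) (+-identityʳ (iverson q))
  ∑-iverson {suc b} q (suc k) = cong₂ _+_ (cong iverson (∧-zeroʳ q)) (∑-iverson q k)

record Enumeration {v} (f : Fin v → Bool) (k : ℕ) : Set where
  field
    at : Fin k → Fin v
    at-sat : ∀ t → f (at t) ≡ true
    at-injective : ∀ {s t} → at s ≡ at t → s ≡ t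
    at-onto : ∀ x → f x ≡ true → Σ (Fin k) λ t → at t ≡ x

enumeration : ∀ {v} (f : Fin v → Bool) → Enumeration f (count f)
enumeration {zero} f = record { at = λ () ; at-sat = λ () ; at-injective = λ {} ; at-onto = λ () }
enumeration {suc v} f with f zero in f0 | enumeration (f ∘ suc)
... | true | E = record { at = at ; at-sat = at-sat ; at-injective = at-injective ; at-onto = at-onto }
  where
  module E = Enumeration E
  at : Fin (suc (count (f ∘ suc))) → Fin (suc v)
  at zero = zero
  at (suc t) = suc (E.at t)
  at-sat : ∀ t → f (at t) ≡ true
  at-sat zero = f0
  at-sat (suc t) = E.at-sat t
  at-injective : ∀ {s t} → at s ≡ at t → s ≡ t
  at-injective {zero} {zero} _ = refl
  at-injective {suc s} {suc t} e = cong suc (E.at-injective (Finₚ.suc-injective e))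
  at-onto : ∀ x → f x ≡ true → Σ _ λ t → at t ≡ x
  at-onto zero _ = zero , refl
  at-onto (suc x) fx = let t , e = E.at-onto x fx in suc t , cong suc e
... | false | E = record
  { at = suc ∘ E.at ; at-sat = E.at-sat
  ; at-injective = E.at-injective ∘ Finₚ.suc-injective ; at-onto = at-onto }
  where
  module E = Enumeration E
  at-onto : ∀ x → f x ≡ true → Σ _ λ t → suc (E.at t) ≡ x
  at-onto zero fx = ⊥-elim (false≢true (trans (sym f0) fx))
    where
    false≢true : ¬ false ≡ true
    false≢true ()
  at-onto (suc x) fx = let t , e = E.at-onto x fx in t , cong suc e

enumerationOfSize : ∀ {v k} (f : Fin v → Bool) → count f ≡ k → Enumeration f k
enumerationOfSize f refl = enumeration f

module Index {v k} {f : Fin v → Bool} (E : Enumeration f (suc k)) where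
  open Enumeration E

  private
    index′ : ∀ x b → f x ≡ b → Fin (suc k)
    index′ x true fx = proj₁ (at-onto x fx)
    index′ x false _ = zero

    at-index′ : ∀ x b (fx : f x ≡ b) → b ≡ true → at (index′ x b fx) ≡ x
    at-index′ x true fx _ = proj₂ (at-onto x fx)

  index : Fin v → Fin (suc k)
  index x = index′ x (f x) refl

  at-index : ∀ x → f x ≡ true → at (index x) ≡ x
  at-index x = at-index′ x (f x) refl

  index-at : ∀ t → index (at t) ≡ t
  index-at t = at-injective (at-index (at t) (at-sat t))

-- The affine plane AG(2,3)

Point : Set
Point = Fin 3 × Fin 3

-- The line (zero , c) is the row {c} × 𝔽₃; for k : 𝔽₃ the line (suc k , c) is {(a , c + k a)}.
Line : Set
Line = Fin 4 × Fin 3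

infixl 6 _+₃_ _-₃_
infixl 7 _*₃_

_+₃_ _-₃_ _*₃_ : Fin 3 → Fin 3 → Fin 3
a +₃ b = (toℕ a + toℕ b) mod 3
a -₃ b = (toℕ a + 2 * toℕ b) mod 3
a *₃ b = (toℕ a * toℕ b) mod 3

on : Line → Point → Bool
on (zero , c) (a , b) = a == c
on (suc k , c) (a , b) = b == c +₃ k *₃ a

On : Line → Point → Set
On ℓ p = on ℓ p ≡ true

offset : Fin 4 → Point → Fin 3
offset zero (a , b) = a
offset (suc k) (a , b) = b -₃ k *₃ a

-- The slope (b' − b)/(a' − a) is computed as a product since x⁻¹ = x for x ≠ 0 in 𝔽₃.
lineThrough : Point → Point → Line
lineThrough (a , b) (a' , b') with a ≟ a'
... | yes _ = zero , a
... | no _ = let k = (b' -₃ b) *₃ (a' -₃ a) in suc k , offset (suc k) (a , b)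

pt₁ pt₂ pt₃ : Line → Point
pt₁ (zero , c) = c , 0F
pt₁ (suc k , c) = 0F , c
pt₂ (zero , c) = c , 1F
pt₂ (suc k , c) = 1F , c +₃ k
pt₃ (zero , c) = c , 2F
pt₃ (suc k , c) = 2F , c +₃ k *₃ 2F

private
  _≟ₚ_ : DecidableEquality Point
  _≟ₚ_ = ≡-dec _≟_ _≟_

  _≟ₗ_ : DecidableEquality Line
  _≟ₗ_ = ≡-dec _≟_ _≟_

  all-pairs? : ∀ {m n} {P : Fin m × Fin n → Set} → (∀ p → Dec (P p)) → Dec (∀ p → P p)
  all-pairs? P? = map′ (λ f (a , b) → f a b) (λ f a b → f (a , b)) (all? λ a → all? λ b → P? (a , b))

  on? : ∀ ℓ p → Dec (On ℓ p)
  on? ℓ p = on ℓ p Bool.≟ true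

lineThrough-unique : ∀ p q ℓ → ¬ p ≡ q → On ℓ p → On ℓ q → ℓ ≡ lineThrough p q
lineThrough-unique = toWitness {a? = all-pairs? λ p → all-pairs? λ q → all-pairs? λ ℓ →
  ¬? (p ≟ₚ q) →-dec on? ℓ p →-dec on? ℓ q →-dec ℓ ≟ₗ lineThrough p q} _

on-lineThrough : ∀ p q → ¬ p ≡ q → On (lineThrough p q) p × On (lineThrough p q) q
on-lineThrough = toWitness {a? = all-pairs? λ p → all-pairs? λ q →
  ¬? (p ≟ₚ q) →-dec on? (lineThrough p q) p ×-dec on? (lineThrough p q) q} _

on-offset : ∀ k p → On (k , offset k p) p
on-offset = toWitness {a? = all? λ k → all-pairs? λ p → on? (k , offset k p) p} _

offset-unique : ∀ k c p → On (k , c) p → c ≡ offset k p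
offset-unique = toWitness {a? = all? λ k → all? λ c → all-pairs? λ p →
  on? (k , c) p →-dec c ≟ offset k p} _

pts-distinct : ∀ ℓ → ¬ pt₁ ℓ ≡ pt₂ ℓ × ¬ pt₁ ℓ ≡ pt₃ ℓ × ¬ pt₂ ℓ ≡ pt₃ ℓ
pts-distinct = toWitness {a? = all-pairs? λ ℓ →
  ¬? (pt₁ ℓ ≟ₚ pt₂ ℓ) ×-dec ¬? (pt₁ ℓ ≟ₚ pt₃ ℓ) ×-dec ¬? (pt₂ ℓ ≟ₚ pt₃ ℓ)} _

on-pts : ∀ ℓ → On ℓ (pt₁ ℓ) × On ℓ (pt₂ ℓ) × On ℓ (pt₃ ℓ)
on-pts = toWitness {a? = all-pairs? λ ℓ → on? ℓ (pt₁ ℓ) ×-dec on? ℓ (pt₂ ℓ) ×-dec on? ℓ (pt₃ ℓ)} _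

on⇒pts : ∀ ℓ p → On ℓ p → p ≡ pt₁ ℓ ⊎ p ≡ pt₂ ℓ ⊎ p ≡ pt₃ ℓ
on⇒pts = toWitness {a? = all-pairs? λ ℓ → all-pairs? λ p →
  on? ℓ p →-dec (p ≟ₚ pt₁ ℓ ⊎-dec p ≟ₚ pt₂ ℓ ⊎-dec p ≟ₚ pt₃ ℓ)} _

-- Partial parallel classes of a Kirkman frame

PartialResolution : ∀ {v u} (grp : Fin v → Fin u) (B : BlockSet v) {r} →
  (Subset v → Fin r) → (Fin r → Fin u) → Set
PartialResolution {v} grp B {r} class hole = ∀ (j : Fin r) (x : Fin v) →
  (grp x ≡ hole j → NoneSat (λ b → B b × class b ≡ j × x ∈ b)) ×
  (¬ grp x ≡ hole j → ExactlyOne (λ b → B b × class b ≡ j × x ∈ b))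

∣∩group∣≡count : ∀ {v u} (p : Subset v) (grp : Fin v → Fin u) i →
  ∣ p ∩ group grp i ∣ ≡ count (λ x → lookup p x ∧ (grp x == i))
∣∩group∣≡count p grp i = trans (∣p∣≡count (p ∩ group grp i)) (count-cong λ x →
  trans (lookup-zipWith _∧_ x p (group grp i))
        (cong (lookup p x ∧_) (lookup∘tabulate (λ y → grp y == i) x)))

group-count : ∀ {v u g} {grp : Fin v → Fin u} {B : BlockSet v} → GDDOn ⊤ grp g B →
  ∀ i → count (λ x → grp x == i) ≡ g
group-count {grp = grp} gdd i =
  trans (count-cong λ x → cong (_∧ (grp x == i)) (sym (lookup-replicate x true)))
        (trans (sym (∣∩group∣≡count ⊤ grp i)) (proj₁ gdd i))

∈⊤ : ∀ {v} (x : Fin v) → x ∈ ⊤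
∈⊤ x = lookup⇒[]= x ⊤ (lookup-replicate x true)

-- Double counting of the points y outside the group of x₀, sorted by the class of the block {x₀, y, ·}.
module ClassesAvoidingAGroup
  {v u g} {grp : Fin v → Fin u} {B : BlockSet v} (gdd : GDDOn ⊤ grp g B)
  {r} {class : Subset v → Fin r} {hole : Fin r → Fin u} (res : PartialResolution grp B class hole)
  (x₀ : Fin v) where

  private
    h = grp x₀
    GDD-triples = proj₁ (proj₂ gdd)
    GDD-transversal = proj₁ (proj₂ (proj₂ gdd))
    GDD-pairs = proj₂ (proj₂ (proj₂ gdd))

    blockWith : ∀ y → ¬ grp y ≡ h → ExactlyOne (λ b → B b × x₀ ∈ b × y ∈ b)
    blockWith y y∉h = GDD-pairs x₀ y (∈⊤ x₀) (∈⊤ y) (y∉h ∘ sym)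

    classOf : Fin v → Fin (suc r)
    classOf y with grp y ≟ h
    ... | yes _ = zero
    ... | no y∉h = suc (class (proj₁ (blockWith y y∉h)))

    fibre-zero : count (λ y → classOf y == zero) ≡ g
    fibre-zero = trans (count-cong same) (group-count gdd h)
      where
      same : ∀ y → (classOf y == zero) ≡ (grp y == h)
      same y with grp y ≟ h
      ... | yes _ = refl
      ... | no _ = refl

    fibre-at-hole : ∀ j → hole j ≡ h → count (λ y → classOf y == suc j) ≡ 0
    fibre-at-hole j hole≡h = count-false _ none
      where
      none : ∀ y → (classOf y == suc j) ≡ false
      none y with grp y ≟ h
      ... | yes _ = refl
      ... | no y∉h with class (proj₁ (blockWith y y∉h)) ≟ j
      ...   | no _ = refl
      ...   | yes c≡j = ⊥-elim (proj₁ (res j x₀) (sym hole≡h) _ (B∋ , c≡j , x₀∈))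
        where
        B∋ = proj₁ (proj₁ (proj₂ (blockWith y y∉h)))
        x₀∈ = proj₁ (proj₂ (proj₁ (proj₂ (blockWith y y∉h))))

    module _ (j : Fin r) (hole≢h : ¬ hole j ≡ h) where
      cover = proj₂ (res j x₀) (hole≢h ∘ sym)
      β = proj₁ cover
      Bβ = proj₁ (proj₁ (proj₂ cover))
      classβ = proj₁ (proj₂ (proj₁ (proj₂ cover)))
      x₀∈β = proj₂ (proj₂ (proj₁ (proj₂ cover)))
      β-unique = proj₂ (proj₂ cover)

      fibre-is-β : ∀ y → (classOf y == suc j) ≡ (not (y == x₀) ∧ lookup β y)
      fibre-is-β y with grp y ≟ h
      ... | yes y∈h = sym (¬-not λ t → not-¬ (≡⇒== (same-group t)) (not-true (∧-conicalˡ _ _ t)))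
        where
        same-group : (not (y == x₀) ∧ lookup β y) ≡ true → y ≡ x₀
        same-group t = GDD-transversal β Bβ y x₀ (lookup⇒[]= y β (∧-conicalʳ _ _ t)) x₀∈β y∈h
      ... | no y∉h = ≡true-ext to from
        where
        γ = proj₁ (blockWith y y∉h)
        Bγ = proj₁ (proj₁ (proj₂ (blockWith y y∉h)))
        x₀∈γ = proj₁ (proj₂ (proj₁ (proj₂ (blockWith y y∉h))))
        y∈γ = proj₂ (proj₂ (proj₁ (proj₂ (blockWith y y∉h))))
        γ-unique = proj₂ (proj₂ (blockWith y y∉h))
        to : (class γ == j) ≡ true → (not (y == x₀) ∧ lookup β y) ≡ true
        to c≡j = cong₂ _∧_ (cong not (≢⇒==false λ y≡x₀ → y∉h (cong grp y≡x₀)))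
          ([]=⇒lookup (subst (y ∈_) (β-unique γ (Bγ , ==⇒≡ c≡j , x₀∈γ)) y∈γ))
        from : (not (y == x₀) ∧ lookup β y) ≡ true → (class γ == j) ≡ true
        from t = ≡⇒== (trans (cong class (sym (γ-unique β (Bβ , x₀∈β , lookup⇒[]= y β (∧-conicalʳ _ _ t))))) classβ)

      fibre-off-hole : count (λ y → classOf y == suc j) ≡ 2
      fibre-off-hole = +-cancelʳ-≡ 1 _ _ (trans (cong (_+ 1) (count-cong fibre-is-β))
        (trans (count-remove (lookup β) x₀ ([]=⇒lookup x₀∈β))
               (trans (sym (∣p∣≡count β)) (proj₁ (GDD-triples β Bβ)))))

    fibre-suc : ∀ j → count (λ y → classOf y == suc j) ≡ 2 * iverson (not (hole j == h))
    fibre-suc j with hole j ≟ h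
    ... | yes hole≡h = fibre-at-hole j hole≡h
    ... | no hole≢h = fibre-off-hole j hole≢h

  classes-avoiding : 2 * count (λ j → not (hole j == h)) + g ≡ v
  classes-avoiding = begin
    2 * count (λ j → not (hole j == h)) + g
      ≡⟨ +-comm _ g ⟩
    g + 2 * count (λ j → not (hole j == h))
      ≡⟨ cong₂ _+_ (sym fibre-zero) (*-distribˡ-sum 2 (λ j → iverson (not (hole j == h)))) ⟩
    count (λ y → classOf y == zero) + ∑[ j < r ] (2 * iverson (not (hole j == h)))
      ≡⟨ cong (count (λ y → classOf y == zero) +_) (sum-cong-≗ (sym ∘ fibre-suc)) ⟩
    ∑[ j < suc r ] count (λ y → classOf y == j)
      ≡⟨ sym (count-fibres (λ _ → true) classOf) ⟩
    count {v} (λ _ → true)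
      ≡⟨ count-true ⟩
    v ∎
    where open ≡-Reasoning

hole-multiplicity : ∀ {c k} .{{_ : NonZero c}}
  {grp : Fin (2 * c * suc (suc k)) → Fin (suc (suc k))} {B : BlockSet (2 * c * suc (suc k))} →
  GDDOn ⊤ grp (2 * c) B →
  ∀ {r} {class : Subset (2 * c * suc (suc k)) → Fin r} {hole : Fin r → Fin (suc (suc k))} →
  PartialResolution grp B class hole → ∀ h → count (λ j → hole j == h) ≡ c
hole-multiplicity {c} {k} {grp} gdd {r} {class} {hole} res h = +-cancelʳ-≡ (c * suc k) _ _ (begin
  H h + c * suc k ≡⟨ cong (H h +_) (sym (D≡ h)) ⟩
  H h + D h       ≡⟨ H+D≡r h ⟩
  r               ≡⟨ r≡ ⟩
  c * u           ≡⟨ *-suc c (suc k) ⟩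
  c + c * suc k   ∎)
  where
  open ≡-Reasoning
  u = suc (suc k)

  H D : Fin u → ℕ
  H h = count (λ j → hole j == h)
  D h = count (λ j → not (hole j == h))

  H+D≡r : ∀ h → H h + D h ≡ r
  H+D≡r h = trans (sym (cong₂ _+_ (count-cong λ j → ∧-identityʳ (hole j == h))
                                   (count-cong λ j → ∧-identityʳ (not (hole j == h)))))
                  (trans (count-partition (λ j → hole j == h) (λ _ → true)) count-true)

  ∑H≡r : ∑[ h < u ] H h ≡ r
  ∑H≡r = trans (sym (count-fibres (λ _ → true) hole)) count-true

  D≡ : ∀ h → D h ≡ c * suc k
  D≡ h = *-cancelˡ-≡ _ _ 2 (+-cancelʳ-≡ (2 * c) _ _ (trans (subst (λ h → 2 * D h + 2 * c ≡ 2 * c * u) gx₀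
      (ClassesAvoidingAGroup.classes-avoiding gdd res x₀)) (expand c k)))
    where
    member = count≢0⇒witness (λ x → grp x == h)
      (λ e → ≢-nonZero⁻¹ (2 * c) {{m*n≢0 2 c}} (trans (sym (group-count gdd h)) e))
    x₀ = proj₁ member
    gx₀ = ==⇒≡ (proj₂ member)
    expand : ∀ c k → 2 * c * suc (suc k) ≡ 2 * (c * suc k) + 2 * c
    expand = solve-∀

  r≡ : r ≡ c * u
  r≡ = *-cancelˡ-≡ r (c * u) (suc k) (+-cancelˡ-≡ r _ _ (begin
    r + suc k * r                   ≡⟨ sym (∑-const u r) ⟩
    ∑[ h < u ] r                    ≡⟨ sum-cong-≗ (sym ∘ H+D≡r) ⟩
    ∑[ h < u ] (H h + D h)          ≡⟨ ∑-distrib-+ H D ⟩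
    ∑[ h < u ] H h + ∑[ h < u ] D h ≡⟨ cong₂ _+_ ∑H≡r (trans (sum-cong-≗ D≡) (∑-const u (c * suc k))) ⟩
    r + u * (c * suc k)             ≡⟨ cong (r +_) (rearrange c k) ⟩
    r + suc k * (c * u)             ∎))
    where
    rearrange : ∀ c k → suc (suc k) * (c * suc k) ≡ suc k * (c * suc (suc k))
    rearrange = solve-∀

record LabelledResolution {v u} (grp : Fin v → Fin u) (B : BlockSet v) (c : ℕ) : Set where
  field
    r : ℕ
    class : Subset v → Fin r
    hole : Fin r → Fin u
    partial : PartialResolution grp B class hole
    classAt : Fin u → Fin c → Fin r
    label : Fin r → Fin c
    hole-classAt : ∀ h t → hole (classAt h t) ≡ h
    classAt-label : ∀ j → classAt (hole j) (label j) ≡ j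
    label-classAt : ∀ h t → label (classAt h t) ≡ t

labelHoles : ∀ {v u c} {grp : Fin v → Fin u} {B : BlockSet v}
  {r} {class : Subset v → Fin r} {hole : Fin r → Fin u} → PartialResolution grp B class hole →
  (∀ h → count (λ j → hole j == h) ≡ suc c) → LabelledResolution grp B (suc c)
labelHoles {c = c} {r = r} {class} {hole} res multiplicity = record
  { r = r ; class = class ; hole = hole ; partial = res
  ; classAt = classAt ; label = label
  ; hole-classAt = hole-classAt ; classAt-label = classAt-label ; label-classAt = label-classAt }
  where
  withHole : ∀ h → Enumeration (λ j → hole j == h) (suc c)
  withHole h = enumerationOfSize _ (multiplicity h)
  open module W h = Enumeration (withHole h) using () renaming (at to classAt)
  open module I h = Index (withHole h) using (index; at-index; index-at)

  label : Fin r → Fin (suc c)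
  label j = index (hole j) j

  hole-classAt : ∀ h t → hole (classAt h t) ≡ h
  hole-classAt h t = ==⇒≡ (Enumeration.at-sat (withHole h) t)

  classAt-label : ∀ j → classAt (hole j) (label j) ≡ j
  classAt-label j = at-index (hole j) j (==-refl (hole j))

  label-classAt : ∀ h t → label (classAt h t) ≡ t
  label-classAt h t = subst (λ h′ → index h′ (classAt h t) ≡ t) (sym (hole-classAt h t)) (index-at h t)

labelledResolution : ∀ {m} {grp : Fin (6 * suc m) → Fin (suc m)} {B : BlockSet (6 * suc m)} →
  KirkmanFrame grp 6 B → LabelledResolution grp B 3
-- A frame of type 6¹ has no blocks, so three empty classes with hole V₀ will do.
labelledResolution {zero} {grp} {B} (gdd , _) = record
  { r = 3 ; class = λ _ → 0F ; hole = λ _ → 0F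
  ; partial = λ j x → (λ _ b (Bb , _) → no-blocks b Bb) , (λ x∉hole → ⊥-elim (x∉hole (single _ _)))
  ; classAt = λ _ t → t ; label = λ j → j
  ; hole-classAt = λ _ _ → single _ _ ; classAt-label = λ _ → refl ; label-classAt = λ _ _ → refl }
  where
  single : (i j : Fin 1) → i ≡ j
  single zero zero = refl

  no-blocks : ∀ b → ¬ B b
  no-blocks b Bb = zero≢one (at-injective (proj₁ (proj₂ (proj₂ gdd)) b Bb (at 0F) (at 1F)
    (lookup⇒[]= _ b (at-sat 0F)) (lookup⇒[]= _ b (at-sat 1F)) (single _ _)))
    where
    open Enumeration (enumerationOfSize (lookup b) (trans (sym (∣p∣≡count b)) (proj₁ (proj₁ (proj₂ gdd) b Bb))))
    zero≢one : ¬ 0F ≡ 1F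
    zero≢one ()
labelledResolution {suc k} (gdd , r , class , hole , res) = labelHoles res (hole-multiplicity gdd res)

-- Filling the holes

∈tabulate⁺ : ∀ {v} (f : Fin v → Bool) {x} → f x ≡ true → x ∈ tabulate f
∈tabulate⁺ f {x} fx = lookup⇒[]= x (tabulate f) (trans (lookup∘tabulate f x) fx)

∈tabulate⁻ : ∀ {v} (f : Fin v → Bool) {x} → x ∈ tabulate f → f x ≡ true
∈tabulate⁻ f {x} x∈ = trans (sym (lookup∘tabulate f x)) ([]=⇒lookup x∈)

exactlyOne-⊆ : ∀ {v} {P Q : Subset v → Set} → (∀ b → P b → Q b) → ExactlyOne Q →
  ∀ b → P b → ExactlyOne P
exactlyOne-⊆ P⊆Q (_ , _ , unique) b Pb =
  b , Pb , λ b′ Pb′ → trans (unique b′ (P⊆Q b′ Pb′)) (sym (unique b (P⊆Q b Pb)))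

∣p++∅∣≡∣p∣ : ∀ {v k} (p : Subset v) → ∣ p ++ ∅ {k} ∣ ≡ ∣ p ∣
∣p++∅∣≡∣p∣ {k = k} [] = ∣⊥∣≡0 k
∣p++∅∣≡∣p∣ (true ∷ p) = cong suc (∣p++∅∣≡∣p∣ p)
∣p++∅∣≡∣p∣ (false ∷ p) = ∣p++∅∣≡∣p∣ p

module HoleFilling
  {m : ℕ} {grp : Fin (6 * suc m) → Fin (suc m)} {B : BlockSet (6 * suc m)}
  (gdd : GDDOn ⊤ grp 6 B) (R : LabelledResolution grp B 3)
  {W : Subset (6 * suc m)} {A : BlockSet (6 * suc m)} (A⊆B : A ⊆ᴮ B) (sub : GDDOn W grp 3 A) where

  open LabelledResolution R

  N = 6 * suc m
  V = N + 3

  old : Fin N → Fin V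
  old p = p ↑ˡ 3

  ∞ : Fin 3 → Fin V
  ∞ t = N ↑ʳ t

  data Kind : Fin V → Set where
    is-old : ∀ p → Kind (old p)
    is-∞ : ∀ t → Kind (∞ t)

  kind : ∀ x → Kind x
  kind x = subst Kind (Finₚ.join-splitAt N 3 x) (fromSplit (splitAt N x))
    where
    fromSplit : ∀ s → Kind (join N 3 s)
    fromSplit (inj₁ p) = is-old p
    fromSplit (inj₂ t) = is-∞ t

  extend : ∀ {X : Set} → (Fin N → X) → (Fin 3 → X) → Fin V → X
  extend f g x = [ f , g ]′ (splitAt N x)

  extend-old : ∀ {X : Set} (f : Fin N → X) g p → extend f g (old p) ≡ f p
  extend-old f g p = cong [ f , g ]′ (Finₚ.splitAt-↑ˡ N p 3)

  extend-∞ : ∀ {X : Set} (f : Fin N → X) g t → extend f g (∞ t) ≡ g t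
  extend-∞ f g t = cong [ f , g ]′ (Finₚ.splitAt-↑ʳ N 3 t)

  inW : Fin N → Bool
  inW = lookup W

  W-count : ∀ i → count (λ p → inW p ∧ (grp p == i)) ≡ 3
  W-count i = trans (sym (∣∩group∣≡count W grp i)) (proj₁ sub i)

  rest-count : ∀ i → count (λ p → not (inW p) ∧ (grp p == i)) ≡ 3
  rest-count i = +-cancelˡ-≡ 3 _ _
    (trans (cong (_+ count (λ p → not (inW p) ∧ (grp p == i))) (sym (W-count i)))
           (trans (count-partition inW (λ p → grp p == i)) (group-count gdd i)))

  W-enum : ∀ i → Enumeration (λ p → inW p ∧ (grp p == i)) 3
  W-enum i = enumerationOfSize _ (W-count i)

  rest-enum : ∀ i → Enumeration (λ p → not (inW p) ∧ (grp p == i)) 3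
  rest-enum i = enumerationOfSize _ (rest-count i)

  module Wᵢ i = Enumeration (W-enum i)
  module Rᵢ i = Enumeration (rest-enum i)
  module IWᵢ i = Index (W-enum i)
  module IRᵢ i = Index (rest-enum i)

  -- The plane of group i is V_i ∪ {∞₀, ∞₁, ∞₂}, with the points at infinity on row 0,
  -- the points of W on row 1 and the remaining points of V_i on row 2.
  inPlane : Fin (suc m) → Fin V → Bool
  inPlane i = extend (λ p → grp p == i) (λ _ → true)

  emb : Fin (suc m) → Point → Fin V
  emb i (0F , t) = ∞ t
  emb i (1F , t) = old (Wᵢ.at i t)
  emb i (2F , t) = old (Rᵢ.at i t)

  oldCoord : Fin N → Bool → Point
  oldCoord p true = 1F , IWᵢ.index (grp p) p
  oldCoord p false = 2F , IRᵢ.index (grp p) p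

  coord : Fin V → Point
  coord = extend (λ p → oldCoord p (inW p)) (0F ,_)

  coord-old : ∀ p → coord (old p) ≡ oldCoord p (inW p)
  coord-old = extend-old _ _

  coord-∞ : ∀ t → coord (∞ t) ≡ (0F , t)
  coord-∞ = extend-∞ _ _

  inPlane-old : ∀ i p → inPlane i (old p) ≡ (grp p == i)
  inPlane-old i = extend-old _ _

  inPlane-∞ : ∀ i t → inPlane i (∞ t) ≡ true
  inPlane-∞ i = extend-∞ _ _

  inPlane-grp : ∀ p → inPlane (grp p) (old p) ≡ true
  inPlane-grp p = trans (inPlane-old (grp p) p) (==-refl (grp p))

  inPlane⇒grp : ∀ {i p} → inPlane i (old p) ≡ true → grp p ≡ i
  inPlane⇒grp {i} {p} e = ==⇒≡ (trans (sym (inPlane-old i p)) e)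

  inPlane-emb : ∀ i p → inPlane i (emb i p) ≡ true
  inPlane-emb i (0F , t) = inPlane-∞ i t
  inPlane-emb i (1F , t) = trans (inPlane-old i _) (∧-conicalʳ _ _ (Wᵢ.at-sat i t))
  inPlane-emb i (2F , t) = trans (inPlane-old i _) (∧-conicalʳ _ _ (Rᵢ.at-sat i t))

  coord-emb : ∀ i p → coord (emb i p) ≡ p
  coord-emb i (0F , t) = coord-∞ t
  coord-emb i (1F , t) = begin
    coord (old p)              ≡⟨ coord-old p ⟩
    oldCoord p (inW p)         ≡⟨ cong (oldCoord p) (∧-conicalˡ _ _ (Wᵢ.at-sat i t)) ⟩
    1F , IWᵢ.index (grp p) p   ≡⟨ cong (λ g → 1F , IWᵢ.index g p) (==⇒≡ (∧-conicalʳ _ _ (Wᵢ.at-sat i t))) ⟩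
    1F , IWᵢ.index i p         ≡⟨ cong (1F ,_) (IWᵢ.index-at i t) ⟩
    1F , t                     ∎
    where
    open ≡-Reasoning
    p = Wᵢ.at i t
  coord-emb i (2F , t) = begin
    coord (old p)              ≡⟨ coord-old p ⟩
    oldCoord p (inW p)         ≡⟨ cong (oldCoord p) (not-true (∧-conicalˡ _ _ (Rᵢ.at-sat i t))) ⟩
    2F , IRᵢ.index (grp p) p   ≡⟨ cong (λ g → 2F , IRᵢ.index g p) (==⇒≡ (∧-conicalʳ _ _ (Rᵢ.at-sat i t))) ⟩
    2F , IRᵢ.index i p         ≡⟨ cong (2F ,_) (IRᵢ.index-at i t) ⟩
    2F , t                     ∎
    where
    open ≡-Reasoning
    p = Rᵢ.at i t

  emb-injective : ∀ i {p q} → emb i p ≡ emb i q → p ≡ q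
  emb-injective i {p} {q} e = trans (sym (coord-emb i p)) (trans (cong coord e) (coord-emb i q))

  emb-coord : ∀ i x → inPlane i x ≡ true → emb i (coord x) ≡ x
  emb-coord i x x∈i with kind x
  ... | is-∞ t = cong (emb i) (coord-∞ t)
  ... | is-old p = trans (cong (emb i) (coord-old p)) (emb-oldCoord (inW p) refl)
    where
    grp≡i = inPlane⇒grp x∈i
    emb-oldCoord : ∀ b → inW p ≡ b → emb i (oldCoord p b) ≡ old p
    emb-oldCoord true w = cong old (trans (cong (λ g → Wᵢ.at i (IWᵢ.index g p)) grp≡i)
      (IWᵢ.at-index i p (cong₂ _∧_ w (≡⇒== grp≡i))))
    emb-oldCoord false w = cong old (trans (cong (λ g → Rᵢ.at i (IRᵢ.index g p)) grp≡i)
      (IRᵢ.at-index i p (cong₂ _∧_ (cong not w) (≡⇒== grp≡i))))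

  coord-injective-on : ∀ i {x y} → inPlane i x ≡ true → inPlane i y ≡ true → coord x ≡ coord y → x ≡ y
  coord-injective-on i {x} {y} x∈i y∈i e =
    trans (sym (emb-coord i x x∈i)) (trans (cong (emb i) e) (emb-coord i y y∈i))

  emb-off-row0 : ∀ i a c → Σ (Fin N) λ q → emb i (suc a , c) ≡ old q × grp q ≡ i
  emb-off-row0 i 0F c = Wᵢ.at i c , refl , ==⇒≡ (∧-conicalʳ _ _ (Wᵢ.at-sat i c))
  emb-off-row0 i 1F c = Rᵢ.at i c , refl , ==⇒≡ (∧-conicalʳ _ _ (Rᵢ.at-sat i c))

  ∞-line W-row : Line
  ∞-line = 0F , 0F
  W-row = 0F , 1F

  inLine : Fin (suc m) → Line → Fin V → Bool
  inLine i ℓ x = inPlane i x ∧ on ℓ (coord x)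

  lineBlock : Fin (suc m) → Line → Subset V
  lineBlock i ℓ = tabulate (inLine i ℓ)

  oldBlock : Subset N → Subset V
  oldBlock b = b ++ ∅

  ∈lineBlock⁺ : ∀ {i ℓ x} → inPlane i x ≡ true → On ℓ (coord x) → x ∈ lineBlock i ℓ
  ∈lineBlock⁺ {i} {ℓ} x∈i x∈ℓ = ∈tabulate⁺ (inLine i ℓ) (cong₂ _∧_ x∈i x∈ℓ)

  ∈lineBlock⁻ : ∀ {i ℓ x} → x ∈ lineBlock i ℓ → inPlane i x ≡ true × On ℓ (coord x)
  ∈lineBlock⁻ {i} {ℓ} x∈ = let e = ∈tabulate⁻ (inLine i ℓ) x∈ in ∧-conicalˡ _ _ e , ∧-conicalʳ _ _ e

  emb∈lineBlock : ∀ i {ℓ p} → On ℓ p → emb i p ∈ lineBlock i ℓ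
  emb∈lineBlock i {ℓ} {p} p∈ℓ = ∈lineBlock⁺ {i} {ℓ} (inPlane-emb i p) (subst (On ℓ) (sym (coord-emb i p)) p∈ℓ)

  old∈oldBlock⁺ : ∀ {b p} → p ∈ b → old p ∈ oldBlock b
  old∈oldBlock⁺ {b} {p} p∈b = lookup⇒[]= (old p) (oldBlock b) (trans (lookup-++ˡ b ∅ p) ([]=⇒lookup p∈b))

  old∈oldBlock⁻ : ∀ {b p} → old p ∈ oldBlock b → p ∈ b
  old∈oldBlock⁻ {b} {p} p∈b = lookup⇒[]= p b (trans (sym (lookup-++ˡ b ∅ p)) ([]=⇒lookup p∈b))

  ∞∉oldBlock : ∀ {b t} → ¬ ∞ t ∈ oldBlock b
  ∞∉oldBlock {b} {t} ∞∈b with trans (sym (trans (lookup-++ʳ b ∅ t) (lookup-replicate t false))) ([]=⇒lookup ∞∈b)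
  ... | ()

  on-∞-line-old : ∀ p → on ∞-line (coord (old p)) ≡ false
  on-∞-line-old p rewrite coord-old p with inW p
  ... | true = refl
  ... | false = refl

  lineBlock-∞-line : ∀ i j → lineBlock i ∞-line ≡ lineBlock j ∞-line
  lineBlock-∞-line i j = tabulate-cong λ x → trans (only-∞ i x) (sym (only-∞ j x))
    where
    only-∞ : ∀ i x → (inPlane i x ∧ on ∞-line (coord x)) ≡ on ∞-line (coord x)
    only-∞ i x with kind x
    ... | is-old p rewrite on-∞-line-old p = ∧-zeroʳ _
    ... | is-∞ t rewrite inPlane-∞ i t = refl

  lineBlock-rehome : ∀ {i g ℓ x} → x ∈ lineBlock i ℓ → inPlane g x ≡ true →
    (∀ {t} → x ≡ ∞ t → ℓ ≡ ∞-line) → lineBlock i ℓ ≡ lineBlock g ℓ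
  lineBlock-rehome {i} {g} {ℓ} {x} x∈ x∈g ∞⇒∞-line with kind x
  ... | is-old p = cong (λ h → lineBlock h ℓ)
    (trans (sym (inPlane⇒grp {i} {p} (proj₁ (∈lineBlock⁻ {i} {ℓ} x∈)))) (inPlane⇒grp {g} {p} x∈g))
  ... | is-∞ t rewrite ∞⇒∞-line refl = lineBlock-∞-line i g

  oldBlock-meets-plane-once : ∀ {b g x y} → B b → x ∈ oldBlock b → y ∈ oldBlock b →
    inPlane g x ≡ true → inPlane g y ≡ true → x ≡ y
  oldBlock-meets-plane-once {b} {g} {x} {y} Bb x∈b y∈b x∈g y∈g with kind x | kind y
  ... | is-∞ _ | _ = ⊥-elim (∞∉oldBlock x∈b)
  ... | is-old _ | is-∞ _ = ⊥-elim (∞∉oldBlock y∈b)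
  ... | is-old p | is-old q = cong old (proj₁ (proj₂ (proj₂ gdd)) b Bb p q
    (old∈oldBlock⁻ x∈b) (old∈oldBlock⁻ y∈b) (trans (inPlane⇒grp x∈g) (sym (inPlane⇒grp y∈g))))

  ∣lineBlock∣ : ∀ i ℓ → ∣ lineBlock i ℓ ∣ ≡ 3
  ∣lineBlock∣ i ℓ = trans (∣tabulate∣≡count (inLine i ℓ)) (trans (count-cong on-three)
    (count-three (d₁₂ ∘ emb-injective i) (d₁₃ ∘ emb-injective i) (d₂₃ ∘ emb-injective i)))
    where
    d₁₂ = proj₁ (pts-distinct ℓ)
    d₁₃ = proj₁ (proj₂ (pts-distinct ℓ))
    d₂₃ = proj₂ (proj₂ (pts-distinct ℓ))
    e₁ = emb i (pt₁ ℓ)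
    e₂ = emb i (pt₂ ℓ)
    e₃ = emb i (pt₃ ℓ)
    on-three : ∀ x → inLine i ℓ x ≡ ((x == e₁) ∨ ((x == e₂) ∨ (x == e₃)))
    on-three x = ≡true-ext to from
      where
      is-emb : ∀ {p} → coord x ≡ p → inPlane i x ≡ true → (x == emb i p) ≡ true
      is-emb {p} e x∈i = ≡⇒== (trans (sym (emb-coord i x x∈i)) (cong (emb i) e))
      to : inLine i ℓ x ≡ true → ((x == e₁) ∨ ((x == e₂) ∨ (x == e₃))) ≡ true
      to t with on⇒pts ℓ (coord x) (∧-conicalʳ _ _ t) | ∧-conicalˡ _ _ t
      ... | inj₁ e | x∈i rewrite is-emb {pt₁ ℓ} e x∈i = refl
      ... | inj₂ (inj₁ e) | x∈i rewrite is-emb {pt₂ ℓ} e x∈i = ∨-zeroʳ (x == e₁)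
      ... | inj₂ (inj₂ e) | x∈i rewrite is-emb {pt₃ ℓ} e x∈i | ∨-zeroʳ (x == e₂) = ∨-zeroʳ (x == e₁)
      back : ∀ p → x ≡ emb i p → On ℓ p → inLine i ℓ x ≡ true
      back p refl p∈ℓ = cong₂ _∧_ (inPlane-emb i p) (subst (On ℓ) (sym (coord-emb i p)) p∈ℓ)
      from : ((x == e₁) ∨ ((x == e₂) ∨ (x == e₃))) ≡ true → inLine i ℓ x ≡ true
      from t with ∨-true (x == e₁) t
      ... | inj₁ x≡e₁ = back (pt₁ ℓ) (==⇒≡ x≡e₁) (proj₁ (on-pts ℓ))
      ... | inj₂ t′ with ∨-true (x == e₂) t′
      ...   | inj₁ x≡e₂ = back (pt₂ ℓ) (==⇒≡ x≡e₂) (proj₁ (proj₂ (on-pts ℓ)))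
      ...   | inj₂ x≡e₃ = back (pt₃ ℓ) (==⇒≡ x≡e₃) (proj₂ (proj₂ (on-pts ℓ)))

  old≢∞ : ∀ {p t} → ¬ old p ≡ ∞ t
  old≢∞ {p} {t} e with trans (sym (Finₚ.splitAt-↑ˡ N p 3)) (trans (cong (splitAt N) e) (Finₚ.splitAt-↑ʳ N 3 t))
  ... | ()

  plane-of-old : ∀ {i ℓ q} → old q ∈ lineBlock i ℓ → grp q ≡ i
  plane-of-old {i} {ℓ} {q} q∈ = inPlane⇒grp {i} {q} (proj₁ (∈lineBlock⁻ {i} {ℓ} q∈))

  lineBlock-rehome₂ : ∀ {g i ℓ x y} → inPlane g x ≡ true → inPlane g y ≡ true → ¬ x ≡ y →
    x ∈ lineBlock i ℓ → y ∈ lineBlock i ℓ → lineBlock i ℓ ≡ lineBlock g ℓ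
  lineBlock-rehome₂ {g} {i} {ℓ} {x} {y} x∈g y∈g x≢y x∈ℓ y∈ℓ with kind x | kind y
  ... | is-old p | _ = lineBlock-rehome {i} {g} {ℓ} x∈ℓ x∈g (λ e → ⊥-elim (old≢∞ e))
  ... | is-∞ s | is-old q = lineBlock-rehome {i} {g} {ℓ} y∈ℓ y∈g (λ e → ⊥-elim (old≢∞ e))
  ... | is-∞ s | is-∞ t = lineBlock-rehome {i} {g} {ℓ} x∈ℓ x∈g (λ _ → ℓ≡∞-line)
    where
    s≢t : ¬ (0F , s) ≡ (0F , t)
    s≢t e = x≢y (cong (∞ ∘ proj₂) e)
    on-ℓ : ∀ u → ∞ u ∈ lineBlock i ℓ → On ℓ (0F , u)
    on-ℓ u u∈ℓ = subst (On ℓ) (coord-∞ u) (proj₂ (∈lineBlock⁻ {i} {ℓ} u∈ℓ))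
    ℓ≡∞-line : ℓ ≡ ∞-line
    ℓ≡∞-line = trans (lineThrough-unique _ _ ℓ s≢t (on-ℓ s x∈ℓ) (on-ℓ t y∈ℓ))
                     (sym (lineThrough-unique _ _ ∞-line s≢t refl refl))

  lineBlock-injective : ∀ {i ℓ i′ ℓ′} → lineBlock i ℓ ≡ lineBlock i′ ℓ′ → ℓ ≡ ℓ′ × (ℓ ≡ ∞-line ⊎ i ≡ i′)
  lineBlock-injective {i} {ℓ} {i′} {ℓ′} E = trans ℓ≡ (sym ℓ′≡) , same-plane a b refl refl
    where
    a = pt₁ ℓ
    b = pt₂ ℓ
    a≢b = proj₁ (pts-distinct ℓ)
    a∈ℓ = proj₁ (on-pts ℓ)
    b∈ℓ = proj₁ (proj₂ (on-pts ℓ))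
    moved : ∀ {p} → On ℓ p → emb i p ∈ lineBlock i′ ℓ′
    moved {p} p∈ℓ = subst (emb i p ∈_) E (emb∈lineBlock i {ℓ} {p} p∈ℓ)
    on-ℓ′ : ∀ {p} → On ℓ p → On ℓ′ p
    on-ℓ′ {p} p∈ℓ = subst (On ℓ′) (coord-emb i p) (proj₂ (∈lineBlock⁻ {i′} {ℓ′} (moved p∈ℓ)))
    ℓ≡ = lineThrough-unique a b ℓ a≢b a∈ℓ b∈ℓ
    ℓ′≡ = lineThrough-unique a b ℓ′ a≢b (on-ℓ′ a∈ℓ) (on-ℓ′ b∈ℓ)
    off-row0 : ∀ r c → On ℓ (suc r , c) → i ≡ i′
    off-row0 r c p∈ℓ with emb-off-row0 i r c
    ... | q , e , grp≡i = trans (sym grp≡i) (plane-of-old {i′} {ℓ′} (subst (_∈ lineBlock i′ ℓ′) e (moved p∈ℓ)))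
    same-plane : ∀ a′ b′ → a ≡ a′ → b ≡ b′ → ℓ ≡ ∞-line ⊎ i ≡ i′
    same-plane (suc r , c) _ a≡ _ = inj₂ (off-row0 r c (subst (On ℓ) a≡ a∈ℓ))
    same-plane (0F , _) (suc r , c) _ b≡ = inj₂ (off-row0 r c (subst (On ℓ) b≡ b∈ℓ))
    same-plane (0F , s) (0F , t) a≡ b≡ = inj₁ (trans ℓ≡ (sym (lineThrough-unique a b ∞-line a≢b
      (subst (On ∞-line) (sym a≡) refl) (subst (On ∞-line) (sym b≡) refl))))

  oldBlock≢lineBlock : ∀ {b} → B b → ∀ i ℓ → ¬ oldBlock b ≡ lineBlock i ℓ
  oldBlock≢lineBlock {b} Bb i ℓ E = proj₁ (pts-distinct ℓ) (emb-injective i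
    (oldBlock-meets-plane-once {b} {i} Bb (in-b (proj₁ (on-pts ℓ))) (in-b (proj₁ (proj₂ (on-pts ℓ))))
      (inPlane-emb i (pt₁ ℓ)) (inPlane-emb i (pt₂ ℓ))))
    where
    in-b : ∀ {p} → On ℓ p → emb i p ∈ oldBlock b
    in-b {p} p∈ℓ = subst (emb i p ∈_) (sym E) (emb∈lineBlock i {ℓ} {p} p∈ℓ)

  IsLineBlock : Subset V → Set
  IsLineBlock b = Σ (Fin (suc m)) λ i → Σ Line λ ℓ → b ≡ lineBlock i ℓ

  lineBlock? : ∀ b → Dec (IsLineBlock b)
  lineBlock? b = map′ (λ (i , k , c , e) → i , (k , c) , e) (λ (i , (k , c) , e) → i , k , c , e)
    (any? λ i → any? λ k → any? λ c → Vec.≡-dec Bool._≟_ b (lineBlock i (k , c)))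

  -- Class 0 consists of the rows of all the planes; class suc j completes the frame class j
  -- by a parallel class of the plane of its hole.
  lineClass : Fin (suc m) → Line → Fin (suc r)
  lineClass i (zero , c) = zero
  lineClass i (suc k , c) = suc (classAt i k)

  lineClass-cong : ∀ i ℓ i′ ℓ′ → lineBlock i ℓ ≡ lineBlock i′ ℓ′ → lineClass i ℓ ≡ lineClass i′ ℓ′
  lineClass-cong i ℓ i′ ℓ′ E = subst (λ ℓ″ → lineClass i ℓ ≡ lineClass i′ ℓ″) (proj₁ inj) (same (proj₂ inj))
    where
    inj = lineBlock-injective {i} {ℓ} {i′} {ℓ′} E
    same : ℓ ≡ ∞-line ⊎ i ≡ i′ → lineClass i ℓ ≡ lineClass i′ ℓ
    same (inj₁ ℓ≡∞) = subst (λ ℓ → lineClass i ℓ ≡ lineClass i′ ℓ) (sym ℓ≡∞) refl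
    same (inj₂ i≡i′) = cong (λ h → lineClass h ℓ) i≡i′

  restrict : Subset V → Subset N
  restrict b = tabulate (lookup b ∘ old)

  restrict-oldBlock : ∀ b → restrict (oldBlock b) ≡ b
  restrict-oldBlock b = trans (tabulate-cong (lookup-++ˡ b ∅)) (tabulate∘lookup b)

  classBy : ∀ b → Dec (IsLineBlock b) → Fin (suc r)
  classBy b (yes (i , ℓ , _)) = lineClass i ℓ
  classBy b (no _) = suc (class (restrict b))

  newClass : Subset V → Fin (suc r)
  newClass b = classBy b (lineBlock? b)

  newClass-lineBlock : ∀ i ℓ → newClass (lineBlock i ℓ) ≡ lineClass i ℓ
  newClass-lineBlock i ℓ = by (lineBlock? (lineBlock i ℓ))
    where
    by : ∀ d → classBy (lineBlock i ℓ) d ≡ lineClass i ℓ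
    by (yes (i′ , ℓ′ , E)) = sym (lineClass-cong i ℓ i′ ℓ′ E)
    by (no ¬line) = ⊥-elim (¬line (i , ℓ , refl))

  newClass-oldBlock : ∀ {b} → B b → newClass (oldBlock b) ≡ suc (class b)
  newClass-oldBlock {b} Bb = by (lineBlock? (oldBlock b))
    where
    by : ∀ d → classBy (oldBlock b) d ≡ suc (class b)
    by (yes (i , ℓ , E)) = ⊥-elim (oldBlock≢lineBlock {b} Bb i ℓ E)
    by (no _) = cong (λ b₀ → suc (class b₀)) (restrict-oldBlock b)

  B⁺ : BlockSet V
  B⁺ b = (Σ (Subset N) λ b₀ → B b₀ × b ≡ oldBlock b₀) ⊎ IsLineBlock b

  B⁺-triples : TriplesIn ⊤ B⁺
  B⁺-triples _ (inj₁ (b , Bb , refl)) = trans (∣p++∅∣≡∣p∣ b) (proj₁ (proj₁ (proj₂ gdd) b Bb)) , λ x _ → ∈⊤ x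
  B⁺-triples _ (inj₂ (i , ℓ , refl)) = ∣lineBlock∣ i ℓ , λ x _ → ∈⊤ x

  PairCover : Fin V → Fin V → Set
  PairCover x y = ExactlyOne (λ b → B⁺ b × x ∈ b × y ∈ b)

  planePair : ∀ g {x y} → inPlane g x ≡ true → inPlane g y ≡ true → ¬ x ≡ y → PairCover x y
  planePair g {x} {y} x∈g y∈g x≢y =
    lineBlock g L ,
    (inj₂ (g , L , refl) , ∈lineBlock⁺ {g} {L} x∈g (proj₁ on-L) , ∈lineBlock⁺ {g} {L} y∈g (proj₂ on-L)) ,
    unique
    where
    coords≢ : ¬ coord x ≡ coord y
    coords≢ = x≢y ∘ coord-injective-on g x∈g y∈g
    L = lineThrough (coord x) (coord y)
    on-L = on-lineThrough _ _ coords≢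
    unique : ∀ b → B⁺ b × x ∈ b × y ∈ b → b ≡ lineBlock g L
    unique _ (inj₁ (b , Bb , refl) , x∈b , y∈b) = ⊥-elim (x≢y (oldBlock-meets-plane-once {b} {g} Bb x∈b y∈b x∈g y∈g))
    unique _ (inj₂ (i , ℓ , refl) , x∈ℓ , y∈ℓ) = trans (lineBlock-rehome₂ {g} {i} {ℓ} x∈g y∈g x≢y x∈ℓ y∈ℓ)
      (cong (lineBlock g) (lineThrough-unique _ _ ℓ coords≢
        (proj₂ (∈lineBlock⁻ {i} {ℓ} x∈ℓ)) (proj₂ (∈lineBlock⁻ {i} {ℓ} y∈ℓ))))

  crossPair : ∀ p q → ¬ grp p ≡ grp q → PairCover (old p) (old q)
  crossPair p q p≁q = oldBlock b , (inj₁ (b , Bb , refl) , old∈oldBlock⁺ p∈b , old∈oldBlock⁺ q∈b) , unique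
    where
    pair = proj₂ (proj₂ (proj₂ gdd)) p q (∈⊤ p) (∈⊤ q) p≁q
    b = proj₁ pair
    Bb = proj₁ (proj₁ (proj₂ pair))
    p∈b = proj₁ (proj₂ (proj₁ (proj₂ pair)))
    q∈b = proj₂ (proj₂ (proj₁ (proj₂ pair)))
    unique : ∀ b′ → B⁺ b′ × old p ∈ b′ × old q ∈ b′ → b′ ≡ oldBlock b
    unique _ (inj₁ (b′ , Bb′ , refl) , p∈ , q∈) =
      cong oldBlock (proj₂ (proj₂ pair) b′ (Bb′ , old∈oldBlock⁻ {b′} p∈ , old∈oldBlock⁻ {b′} q∈))
    unique _ (inj₂ (i , ℓ , refl) , p∈ , q∈) =
      ⊥-elim (p≁q (trans (plane-of-old {i} {ℓ} p∈) (sym (plane-of-old {i} {ℓ} q∈))))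

  B⁺-pairs : ∀ x y → ¬ x ≡ y → PairCover x y
  B⁺-pairs x y x≢y with kind x | kind y
  ... | is-old p | is-old q with grp p ≟ grp q
  ...   | no p≁q = crossPair p q p≁q
  ...   | yes p∼q = planePair (grp p) (inPlane-grp p) (trans (inPlane-old _ q) (≡⇒== (sym p∼q))) x≢y
  B⁺-pairs _ _ x≢y | is-old p | is-∞ t = planePair (grp p) (inPlane-grp p) (inPlane-∞ _ t) x≢y
  B⁺-pairs _ _ x≢y | is-∞ s | is-old q = planePair (grp q) (inPlane-∞ _ s) (inPlane-grp q) x≢y
  B⁺-pairs _ _ x≢y | is-∞ s | is-∞ t = planePair 0F (inPlane-∞ _ s) (inPlane-∞ _ t) x≢y

  Covers : Fin (suc r) → Fin V → Set
  Covers c x = ExactlyOne (λ b → B⁺ b × newClass b ≡ c × x ∈ b)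

  rowCover : ∀ g x → inPlane g x ≡ true → Covers zero x
  rowCover g x x∈g =
    lineBlock g ℓ₀ ,
    (inj₂ (g , ℓ₀ , refl) , newClass-lineBlock g ℓ₀ , ∈lineBlock⁺ {g} {ℓ₀} x∈g (on-offset 0F (coord x))) ,
    unique
    where
    ℓ₀ = 0F , offset 0F (coord x)
    unique : ∀ b → B⁺ b × newClass b ≡ zero × x ∈ b → b ≡ lineBlock g ℓ₀
    unique _ (inj₁ (b , Bb , refl) , cls , _) = ⊥-elim (Finₚ.0≢1+n (trans (sym cls) (newClass-oldBlock Bb)))
    unique _ (inj₂ (i , (suc k , c) , refl) , cls , _) =
      ⊥-elim (Finₚ.0≢1+n (trans (sym cls) (newClass-lineBlock i (suc k , c))))
    unique _ (inj₂ (i , (zero , c) , refl) , _ , x∈ℓ) =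
      trans (lineBlock-rehome {i} {g} {0F , c} x∈ℓ x∈g ∞-row)
            (cong (λ c → lineBlock g (0F , c)) (offset-unique 0F c (coord x) x-on))
      where
      x-on : On (0F , c) (coord x)
      x-on = proj₂ (∈lineBlock⁻ {i} {0F , c} x∈ℓ)
      ∞-row : ∀ {t} → x ≡ ∞ t → (0F , c) ≡ ∞-line
      ∞-row {t} x≡∞ = cong (0F ,_) (sym (==⇒≡ (subst (On (0F , c)) (trans (cong coord x≡∞) (coord-∞ t)) x-on)))

  holeCover : ∀ j x → inPlane (hole j) x ≡ true → (∀ b → B b → class b ≡ j → ¬ x ∈ oldBlock b) → Covers (suc j) x
  holeCover j x x∈h notOld =
    lineBlock h ℓ₀ , (inj₂ (h , ℓ₀ , refl) , trans (newClass-lineBlock h ℓ₀) (cong suc (classAt-label j)) ,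
                      ∈lineBlock⁺ {h} {ℓ₀} x∈h (on-offset (suc (label j)) (coord x))) ,
    unique
    where
    h = hole j
    ℓ₀ = suc (label j) , offset (suc (label j)) (coord x)
    unique : ∀ b → B⁺ b × newClass b ≡ suc j × x ∈ b → b ≡ lineBlock h ℓ₀
    unique _ (inj₁ (b , Bb , refl) , cls , x∈b) =
      ⊥-elim (notOld b Bb (Finₚ.suc-injective (trans (sym (newClass-oldBlock Bb)) cls)) x∈b)
    unique _ (inj₂ (i , (zero , c) , refl) , cls , _) =
      ⊥-elim (Finₚ.0≢1+n (trans (sym (newClass-lineBlock i (zero , c))) cls))
    unique _ (inj₂ (i , (suc k , c) , refl) , cls , x∈ℓ) = cong₂ lineBlock i≡h (cong₂ _,_ (cong suc k≡) c≡)
      where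
      at≡j : classAt i k ≡ j
      at≡j = Finₚ.suc-injective (trans (sym (newClass-lineBlock i (suc k , c))) cls)
      i≡h : i ≡ h
      i≡h = trans (sym (hole-classAt i k)) (cong hole at≡j)
      k≡ : k ≡ label j
      k≡ = trans (sym (label-classAt i k)) (cong label at≡j)
      c≡ : c ≡ offset (suc (label j)) (coord x)
      c≡ = trans (offset-unique (suc k) c (coord x) (proj₂ (∈lineBlock⁻ {i} {suc k , c} x∈ℓ)))
                 (cong (λ k → offset (suc k) (coord x)) k≡)

  awayCover : ∀ j p → ¬ grp p ≡ hole j → Covers (suc j) (old p)
  awayCover j p away =
    oldBlock β , (inj₁ (β , Bβ , refl) , trans (newClass-oldBlock Bβ) (cong suc classβ) , old∈oldBlock⁺ p∈β) , unique
    where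
    cover = proj₂ (partial j p) away
    β = proj₁ cover
    Bβ = proj₁ (proj₁ (proj₂ cover))
    classβ = proj₁ (proj₂ (proj₁ (proj₂ cover)))
    p∈β = proj₂ (proj₂ (proj₁ (proj₂ cover)))
    unique : ∀ b → B⁺ b × newClass b ≡ suc j × old p ∈ b → b ≡ oldBlock β
    unique _ (inj₁ (b , Bb , refl) , cls , p∈b) = cong oldBlock (proj₂ (proj₂ cover) b
      (Bb , Finₚ.suc-injective (trans (sym (newClass-oldBlock Bb)) cls) , old∈oldBlock⁻ {b} p∈b))
    unique _ (inj₂ (i , (zero , c) , refl) , cls , _) =
      ⊥-elim (Finₚ.0≢1+n (trans (sym (newClass-lineBlock i (zero , c))) cls))
    unique _ (inj₂ (i , (suc k , c) , refl) , cls , p∈) = ⊥-elim (away (trans (plane-of-old {i} {suc k , c} p∈)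
      (trans (sym (hole-classAt i k)) (cong hole at≡j))))
      where
      at≡j : classAt i k ≡ j
      at≡j = Finₚ.suc-injective (trans (sym (newClass-lineBlock i (suc k , c))) cls)

  coversOld : ∀ j p → Dec (grp p ≡ hole j) → Covers (suc j) (old p)
  coversOld j p (no away) = awayCover j p away
  coversOld j p (yes at-hole) = holeCover j (old p) (trans (inPlane-old _ p) (≡⇒== at-hole))
    (λ b Bb cls p∈b → proj₁ (partial j p) at-hole b (Bb , cls , old∈oldBlock⁻ {b} p∈b))

  coversBy : ∀ c {x} → Kind x → Covers c x
  coversBy zero (is-old p) = rowCover (grp p) (old p) (inPlane-grp p)
  coversBy zero (is-∞ t) = rowCover 0F (∞ t) (inPlane-∞ 0F t)
  coversBy (suc j) (is-old p) = coversOld j p (grp p ≟ hole j)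
  coversBy (suc j) (is-∞ t) = holeCover j (∞ t) (inPlane-∞ _ t) (λ b _ _ → ∞∉oldBlock {b})

  B⁺-KTS : KTS V B⁺
  B⁺-KTS = (B⁺-triples , λ x y _ _ → B⁺-pairs x y) , suc r , newClass , λ c x → coversBy c (kind x)

  W⁺ : Subset V
  W⁺ = oldBlock W

  A⁺ : BlockSet V
  A⁺ b = (Σ (Subset N) λ b₀ → A b₀ × b ≡ oldBlock b₀) ⊎ (Σ (Fin (suc m)) λ i → b ≡ lineBlock i W-row)

  A⁺⊆B⁺ : A⁺ ⊆ᴮ B⁺
  A⁺⊆B⁺ _ (inj₁ (b , Ab , e)) = inj₁ (b , A⊆B b Ab , e)
  A⁺⊆B⁺ _ (inj₂ (i , e)) = inj₂ (i , W-row , e)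

  ∣W⁺∣ : ∣ W⁺ ∣ ≡ 3 * suc m
  ∣W⁺∣ = begin
    ∣ W ++ ∅ ∣                                      ≡⟨ ∣p++∅∣≡∣p∣ W ⟩
    ∣ W ∣                                           ≡⟨ ∣p∣≡count W ⟩
    count inW                                       ≡⟨ count-fibres inW grp ⟩
    ∑[ i < suc m ] count (λ p → inW p ∧ (grp p == i)) ≡⟨ sum-cong-≗ W-count ⟩
    ∑[ i < suc m ] 3                                ≡⟨ ∑-const (suc m) 3 ⟩
    suc m * 3                                       ≡⟨ *-comm (suc m) 3 ⟩
    3 * suc m                                       ∎
    where open ≡-Reasoning

  on-W-row⇒W : ∀ p → On W-row (coord (old p)) → p ∈ W
  on-W-row⇒W p on-row = lookup⇒[]= p W (row1 (inW p) refl (subst (On W-row) (coord-old p) on-row))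
    where
    row1 : ∀ b → inW p ≡ b → On W-row (oldCoord p b) → inW p ≡ true
    row1 true w _ = w

  W⇒on-W-row : ∀ p → p ∈ W → On W-row (coord (old p))
  W⇒on-W-row p p∈W = subst (On W-row) (sym (trans (coord-old p) (cong (oldCoord p) ([]=⇒lookup p∈W)))) refl

  ∞∉W⁺ : ∀ {t} → ¬ ∞ t ∈ W⁺
  ∞∉W⁺ {t} = ∞∉oldBlock {W} {t}

  A⁺-within-W⁺ : ∀ b → A⁺ b → ∀ {x} → Kind x → x ∈ b → x ∈ W⁺
  A⁺-within-W⁺ _ (inj₁ (b , Ab , refl)) (is-old p) p∈b =
    old∈oldBlock⁺ (proj₂ (proj₁ (proj₂ sub) b Ab) p (old∈oldBlock⁻ {b} p∈b))
  A⁺-within-W⁺ _ (inj₁ (b , Ab , refl)) (is-∞ t) ∞∈b = ⊥-elim (∞∉oldBlock {b} ∞∈b)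
  A⁺-within-W⁺ _ (inj₂ (i , refl)) (is-old p) p∈ℓ =
    old∈oldBlock⁺ (on-W-row⇒W p (proj₂ (∈lineBlock⁻ {i} {W-row} p∈ℓ)))
  A⁺-within-W⁺ _ (inj₂ (i , refl)) (is-∞ t) ∞∈ℓ
    with subst (On W-row) (coord-∞ t) (proj₂ (∈lineBlock⁻ {i} {W-row} ∞∈ℓ))
  ... | ()

  A⁺-pair : ∀ {x y} → ¬ x ≡ y → ∀ b → A⁺ b → x ∈ b → y ∈ b → ExactlyOne (λ b → A⁺ b × x ∈ b × y ∈ b)
  A⁺-pair {x} {y} x≢y b Ab x∈b y∈b =
    exactlyOne-⊆ (λ b (Ab , x∈ , y∈) → A⁺⊆B⁺ b Ab , x∈ , y∈) (B⁺-pairs x y x≢y) b (Ab , x∈b , y∈b)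

  A⁺-pairsOld : ∀ p q → p ∈ W → q ∈ W → ¬ old p ≡ old q → Dec (grp p ≡ grp q) →
    ExactlyOne (λ b → A⁺ b × old p ∈ b × old q ∈ b)
  A⁺-pairsOld p q p∈W q∈W p≢q (no p≁q) =
    A⁺-pair p≢q (oldBlock α) (inj₁ (α , Aα , refl)) (old∈oldBlock⁺ p∈α) (old∈oldBlock⁺ q∈α)
    where
    pair = proj₂ (proj₂ (proj₂ sub)) p q p∈W q∈W p≁q
    α = proj₁ pair
    Aα = proj₁ (proj₁ (proj₂ pair))
    p∈α = proj₁ (proj₂ (proj₁ (proj₂ pair)))
    q∈α = proj₂ (proj₂ (proj₁ (proj₂ pair)))
  A⁺-pairsOld p q p∈W q∈W p≢q (yes p∼q) = A⁺-pair p≢q (lineBlock g W-row) (inj₂ (g , refl))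
    (∈lineBlock⁺ {g} {W-row} (inPlane-grp p) (W⇒on-W-row p p∈W))
    (∈lineBlock⁺ {g} {W-row} (trans (inPlane-old g q) (≡⇒== (sym p∼q))) (W⇒on-W-row q q∈W))
    where
    g = grp p

  A⁺-pairs : ∀ {x y} → Kind x → Kind y → x ∈ W⁺ → y ∈ W⁺ → ¬ x ≡ y →
    ExactlyOne (λ b → A⁺ b × x ∈ b × y ∈ b)
  A⁺-pairs (is-old p) (is-old q) p∈ q∈ p≢q =
    A⁺-pairsOld p q (old∈oldBlock⁻ {W} p∈) (old∈oldBlock⁻ {W} q∈) p≢q (grp p ≟ grp q)
  A⁺-pairs (is-∞ t) _ ∞∈ _ _ = ⊥-elim (∞∉W⁺ ∞∈)
  A⁺-pairs (is-old _) (is-∞ t) _ ∞∈ _ = ⊥-elim (∞∉W⁺ ∞∈)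

  A⁺-STS : STSOn W⁺ A⁺
  A⁺-STS = (λ b Ab → proj₁ (B⁺-triples b (A⁺⊆B⁺ b Ab)) , λ x → A⁺-within-W⁺ b Ab (kind x)) ,
           λ x y → A⁺-pairs (kind x) (kind y)

theorem4p8 : (n : ℕ) → 1 ≤ n →
    (Σ (Fin (6 * n) → Fin n) λ grp → Σ (BlockSet (6 * n)) λ B →
       KirkmanFrame grp 6 B ×
       Σ (Subset (6 * n)) λ W → Σ (BlockSet (6 * n)) λ A →
         A ⊆ᴮ B × GDDOn W grp 3 A) →
    Σ (BlockSet (6 * n + 3)) λ B → KTS (6 * n + 3) B ×
      Σ (Subset (6 * n + 3)) λ W → Σ (BlockSet (6 * n + 3)) λ A →
        A ⊆ᴮ B × ∣ W ∣ ≡ 3 * n × STSOn W A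
theorem4p8 (suc m) _ (grp , B , frame , W , A , A⊆B , sub) = B⁺ , B⁺-KTS , W⁺ , A⁺ , A⁺⊆B⁺ , ∣W⁺∣ , A⁺-STS
  where open HoleFilling (proj₁ frame) (labelledResolution frame) A⊆B sub
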